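{- Let $G$ be a connected square-stable graph with at least $2$ vertices. Then $\alpha(G)\le\mu(G)$.
   Context: All graphs are finite and simple. $\alpha(G)$ is the maximum size of a stable set (set of pairwise non-adjacent vertices) and $\mu(G)$ the maximum size of a matching. $G^{2}$ is the graph on $V(G)$ in which distinct $u,v$ are adjacent iff $dist_G(u,v)\le 2$; $G$ is square-stable if $\alpha(G)=\alpha(G^{2})$. -}

module Defs where

open import Data.Nat using (ℕ; _≤_; _≥_)
open import Data.Fin using (Fin)
open import Data.Product using (Σ; _×_; ∃-syntax)
open import Data.Sum using (_⊎_)
open import Data.List using (List; length; map; concat; _∷_; [])
open import Data.List.Membership.Propositional using (_∈_)
open import Data.List.Relation.Unary.Unique.Propositional using (Unique)
open import Relation.Binary.PropositionalEquality using (_≡_)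
open import Relation.Nullary using (¬_)
open import Relation.Binary.Construct.Closure.ReflexiveTransitive using (Star)

record Graph (n : ℕ) : Set₁ where
  field
    Adj   : Fin n → Fin n → Set
    irrefl : ∀ {u} → ¬ Adj u u
    sym   : ∀ {u v} → Adj u v → Adj v u
open Graph public

Adj² : ∀ {n} → Graph n → Fin n → Fin n → Set
Adj² G u v = ¬ (u ≡ v) × (Adj G u v ⊎ ∃[ w ] (Adj G u w × Adj G w v))

square : ∀ {n} → Graph n → Graph n
square G = record
  { Adj = Adj² G
  ; irrefl = λ p → Data.Product.proj₁ p _≡_.refl
  ; sym = λ { (ne , Data.Sum.inj₁ a) → (λ e → ne (Relation.Binary.PropositionalEquality.sym e)) , Data.Sum.inj₁ (Graph.sym G a)
            ; (ne , Data.Sum.inj₂ (w , a , b)) → (λ e → ne (Relation.Binary.PropositionalEquality.sym e)) , Data.Sum.inj₂ (w , Graph.sym G b , Graph.sym G a) }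
  }
  where open Data.Product using (_,_)

Connected : ∀ {n} → Graph n → Set
Connected G = ∀ u v → Star (Adj G) u v

IsStable : ∀ {n} → Graph n → List (Fin n) → Set
IsStable G S = Unique S × (∀ {u v} → u ∈ S → v ∈ S → ¬ Adj G u v)

IsAlpha : ∀ {n} → Graph n → ℕ → Set
IsAlpha G k = (∃[ S ] (IsStable G S × length S ≡ k))
            × (∀ S → IsStable G S → length S ≤ k)

-- Matching: a list of edges whose endpoints are all distinct
-- (so edges are pairwise vertex-disjoint; the list of all 2|M| endpoints is duplicate-free).
endpoints : ∀ {n} → List (Fin n × Fin n) → List (Fin n)
endpoints [] = []
endpoints ((u Data.Product., v) ∷ M) = u ∷ v ∷ endpoints M

IsMatching : ∀ {n} → Graph n → List (Fin n × Fin n) → Set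
IsMatching G M = (∀ {e} → e ∈ M → Adj G (Data.Product.proj₁ e) (Data.Product.proj₂ e))
               × Unique (endpoints M)

IsMu : ∀ {n} → Graph n → ℕ → Set
IsMu G k = (∃[ M ] (IsMatching G M × length M ≡ k))
         × (∀ M → IsMatching G M → length M ≤ k)

SquareStable : ∀ {n} → Graph n → Set
SquareStable G = ∀ a b → IsAlpha G a → IsAlpha (square G) b → a ≡ b

-- Since G is connected with at least two vertices, every vertex s has a neighbour p(s).
-- If S is stable in G², distinct s, s' ∈ S are at distance at least 3, so the edges
-- s p(s) (s ∈ S) are pairwise vertex-disjoint: they form a matching of size |S|.
-- Hence α(G) = α(G²) ≤ μ(G). The only non-constructive step is the existence of
-- α(G²), which holds under a double negation; it is removed at the end because
-- a ≤ m is decidable.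
module Submission where

open import Defs
open import Data.Nat using (ℕ; zero; suc; _≤_; _≥_; s≤s; _≤?_)
open import Data.Nat.Properties using (m≤n⇒m<n∨m≡n)
open import Data.Fin using (Fin; punchIn) renaming (zero to fzero)
open import Data.Fin.Properties using (punchInᵢ≢i)
open import Data.Product using (_×_; ∃; ∃-syntax; _,_; proj₁; proj₂)
open import Data.Sum using (_⊎_; inj₁; inj₂)
open import Data.List using (List; length; map; _∷_; [])
open import Data.List.Properties using (length-map)
open import Data.List.Membership.Propositional using (_∈_)
open import Data.List.Membership.Propositional.Properties using (∈-map⁻)
open import Data.List.Relation.Unary.Any using (here; there)
open import Data.List.Relation.Unary.All as All using (_∷_)
open import Data.List.Relation.Unary.AllPairs using (_∷_; [])
open import Data.List.Relation.Unary.Unique.Propositional using (Unique)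
open import Relation.Binary.PropositionalEquality as ≡ using (_≡_; _≢_; refl; subst; ≢-sym)
open import Relation.Binary.Construct.Closure.ReflexiveTransitive using (Star; ε; _◅_)
open import Relation.Nullary using (Dec; yes; no)
open import Relation.Nullary.Decidable using (decidable-stable)
open import Relation.Nullary.Negation using (DoubleNegation; ¬¬-Monad; contradiction)
open import Relation.Nullary.Decidable.Core using (¬¬-excluded-middle)
open import Effect.Monad using (RawMonad)
open import Function using (_∘_)
import Level

open RawMonad (¬¬-Monad {Level.zero})

¬¬-bounded-maximum : (P : ℕ → Set) → P 0 → ∀ c → (∀ j → P j → j ≤ c) →
                     DoubleNegation (∃[ k ] (P k × (∀ j → P j → j ≤ k)))
¬¬-bounded-maximum P p0 zero bounded = pure (0 , p0 , bounded)
¬¬-bounded-maximum P p0 (suc c) bounded = do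
  P[1+c]? ← ¬¬-excluded-middle
  case P[1+c]?
  where
  case : Dec (P (suc c)) → DoubleNegation (∃[ k ] (P k × (∀ j → P j → j ≤ k)))
  case (yes p) = pure (suc c , p , bounded)
  case (no ¬p) = ¬¬-bounded-maximum P p0 c λ j pj → below j pj (m≤n⇒m<n∨m≡n (bounded j pj))
    where
    below : ∀ j → P j → (suc j ≤ suc c ⊎ j ≡ suc c) → j ≤ c
    below j pj (inj₁ (s≤s j≤c)) = j≤c
    below j pj (inj₂ refl)      = contradiction pj ¬p

¬¬-alpha : ∀ {n} (G : Graph n) c → (∀ S → IsStable G S → length S ≤ c) →
           DoubleNegation (∃ (IsAlpha G))
¬¬-alpha G c bounded = do
  (k , realised , maximal) ← ¬¬-bounded-maximum Realised ([] , ([] , λ ()) , refl) c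
                                                 λ { j (S , stable , refl) → bounded S stable }
  pure (k , realised , λ S stable → maximal (length S) (S , stable , refl))
  where
  Realised : ℕ → Set
  Realised j = ∃[ S ] (IsStable G S × length S ≡ j)

stable²⇒stable : ∀ {n} (G : Graph n) S → IsStable (square G) S → IsStable G S
stable²⇒stable G S (unique , stable) =
  unique , λ x∈S y∈S x~y → stable x∈S y∈S ((λ { refl → irrefl G x~y }) , inj₁ x~y)

walk-first-step : ∀ {A : Set} {R : A → A → Set} {x y} → Star R x y → x ≢ y → ∃ (R x)
walk-first-step ε         x≢x = contradiction refl x≢x
walk-first-step (x~z ◅ _) _ = _ , x~z

other-vertex : ∀ {n} → n ≥ 2 → (s : Fin n) → ∃[ v ] (s ≢ v)
other-vertex {suc zero}    (s≤s ()) s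
other-vertex {suc (suc n)} _        s = punchIn s fzero , ≢-sym (punchInᵢ≢i s fzero)

connected⇒neighbour : ∀ {n} (G : Graph n) → n ≥ 2 → Connected G → ∀ s → ∃ (Adj G s)
connected⇒neighbour G n≥2 connected s =
  let (v , s≢v) = other-vertex n≥2 s in walk-first-step (connected s v) s≢v

module PartnerMatching {n} (G : Graph n) (partner : Fin n → Fin n)
                       (adj-partner : ∀ s → Adj G s (partner s)) where

  edges : List (Fin n) → List (Fin n × Fin n)
  edges = map λ s → s , partner s

  Separated : List (Fin n) → Set
  Separated S = ∀ {x y} → x ∈ S → y ∈ S → x ≢ y → x ≢ partner y × partner x ≢ partner y

  stable²⇒separated : ∀ S → IsStable (square G) S → Separated S
  stable²⇒separated S (_ , stable) x∈S y∈S x≢y =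
      (λ { refl → stable x∈S y∈S (x≢y , inj₁ (Graph.sym G (adj-partner _))) })
    , (λ px≡py → stable x∈S y∈S
         (x≢y , inj₂ (_ , adj-partner _ , Graph.sym G (subst (Adj G _) (≡.sym px≡py) (adj-partner _)))))

  ≢partner : ∀ s → s ≢ partner s
  ≢partner s s≡ps = irrefl G (subst (Adj G s) (≡.sym s≡ps) (adj-partner s))

  ∈-endpoints⁻ : ∀ S {z} → z ∈ endpoints (edges S) → ∃[ y ] (y ∈ S × (z ≡ y ⊎ z ≡ partner y))
  ∈-endpoints⁻ (s ∷ S) (here z≡s)          = s , here refl , inj₁ z≡s
  ∈-endpoints⁻ (s ∷ S) (there (here z≡ps)) = s , here refl , inj₂ z≡ps
  ∈-endpoints⁻ (s ∷ S) (there (there z∈E)) =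
    let (y , y∈S , z≡) = ∈-endpoints⁻ S z∈E in y , there y∈S , z≡

  unique-endpoints : ∀ S → Unique S → Separated S → Unique (endpoints (edges S))
  unique-endpoints []      _                _         = []
  unique-endpoints (s ∷ S) (s∉S ∷ unique) separated =
      (≢partner s ∷ All.tabulate (s≢ ∘ ∈-endpoints⁻ S))
    ∷ All.tabulate (ps≢ ∘ ∈-endpoints⁻ S)
    ∷ unique-endpoints S unique (λ x∈S y∈S → separated (there x∈S) (there y∈S))
    where
    s≢ : ∀ {z} → ∃[ y ] (y ∈ S × (z ≡ y ⊎ z ≡ partner y)) → s ≢ z
    s≢ (y , y∈S , inj₁ refl) = All.lookup s∉S y∈S
    s≢ (y , y∈S , inj₂ refl) = proj₁ (separated (here refl) (there y∈S) (All.lookup s∉S y∈S))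

    ps≢ : ∀ {z} → ∃[ y ] (y ∈ S × (z ≡ y ⊎ z ≡ partner y)) → partner s ≢ z
    ps≢ (y , y∈S , inj₁ refl) =
      ≢-sym (proj₁ (separated (there y∈S) (here refl) (≢-sym (All.lookup s∉S y∈S))))
    ps≢ (y , y∈S , inj₂ refl) = proj₂ (separated (here refl) (there y∈S) (All.lookup s∉S y∈S))

  edges-adjacent : ∀ S {e} → e ∈ edges S → Adj G (proj₁ e) (proj₂ e)
  edges-adjacent S e∈ with ∈-map⁻ _ e∈
  ... | s , _ , refl = adj-partner s

  edges-matching : ∀ S → IsStable (square G) S → IsMatching G (edges S)
  edges-matching S stable² =
      edges-adjacent S
    , unique-endpoints S (proj₁ stable²) (stable²⇒separated S stable²)

stable²-size≤μ : ∀ {n} (G : Graph n) → n ≥ 2 → Connected G →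
                 ∀ m → IsMu G m → ∀ S → IsStable (square G) S → length S ≤ m
stable²-size≤μ G n≥2 connected m (_ , maximum) S stable² =
  subst (_≤ m) (length-map _ S) (maximum (edges S) (edges-matching S stable²))
  where
  open PartnerMatching G (λ s → proj₁ (connected⇒neighbour G n≥2 connected s))
                         (λ s → proj₂ (connected⇒neighbour G n≥2 connected s))

lemma2 : ∀ (n : ℕ) (G : Graph n) → n ≥ 2 → Connected G → SquareStable G →
         ∀ a m → IsAlpha G a → IsMu G m → a ≤ m
lemma2 n G n≥2 connected squareStable a m α[G]≡a μ[G]≡m = decidable-stable (a ≤? m) do
  (b , α[G²]≡b) ← ¬¬-alpha (square G) a
                    λ S stable² → proj₂ α[G]≡a S (stable²⇒stable G S stable²)
  let (S , stable² , |S|≡b) = proj₁ α[G²]≡b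
  pure (subst (_≤ m) (≡.trans |S|≡b (≡.sym (squareStable a b α[G]≡a α[G²]≡b)))
              (stable²-size≤μ G n≥2 connected m μ[G]≡m S stable²))
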